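{- Let $n$ be a positive integer and let $B(n)=\left(\binom{a+i+j-2}{j-1}\right)_{1\le i,j\le n}$, with entries regarded as polynomials in $a$. Then for any $I,J\subseteq\{1,\dots,n\}$ with $|I|=|J|=s$ and $J=\{j_1<j_2<\cdots<j_s\}$, the submatrix $B(n)_I^J$ (rows in $I$, columns in $J$) satisfies $$\deg_a\det B(n)_I^J\le(j_1-1)+(j_2-2)+\cdots+(j_s-s).$$
   Context: $\binom{x}{m}=x(x-1)\cdots(x-m+1)/m!$ for integers $m\ge0$. -}

module Defs where

open import Data.Nat as ℕ using (ℕ; zero; suc; _<_; _∸_; _!)
open import Data.Nat.Properties using (_!≢0)
open import Data.Fin as Fin using (Fin; toℕ; punchIn)
open import Data.List using (List; []; _∷_; map)
open import Data.Integer as ℤ using (ℤ)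
open import Data.Rational as ℚ using (ℚ; 0ℚ; 1ℚ)
open import Relation.Binary.PropositionalEquality using (_≡_)

-- Univariate polynomials in the variable a with rational coefficients,
-- represented by (not necessarily normalised) coefficient lists,
-- lowest degree first:  c₀ ∷ c₁ ∷ … ∷ []  =  c₀ + c₁ a + c₂ a² + …

Poly : Set
Poly = List ℚ

coeff : Poly → ℕ → ℚ
coeff []       _       = 0ℚ
coeff (c ∷ p)  zero    = c
coeff (c ∷ p)  (suc k) = coeff p k

infixl 6 _+P_
infixl 7 _*P_ _·P_

_+P_ : Poly → Poly → Poly
[]      +P q       = q
(c ∷ p) +P []      = c ∷ p
(c ∷ p) +P (d ∷ q) = (c ℚ.+ d) ∷ (p +P q)

_·P_ : ℚ → Poly → Poly
c ·P p = map (c ℚ.*_) p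

-P_ : Poly → Poly
-P p = map ℚ.-_ p

_*P_ : Poly → Poly → Poly
[]      *P q = []
(c ∷ p) *P q = (c ·P q) +P (0ℚ ∷ (p *P q))

constP : ℚ → Poly
constP c = c ∷ []

oneP : Poly
oneP = constP 1ℚ

linP : ℚ → Poly
linP c = c ∷ 1ℚ ∷ []

-- deg_a p ≤ d : every coefficient of a^k with k > d vanishes.
-- (The zero polynomial has degree ≤ d for every d.)
DegLe : Poly → ℕ → Set
DegLe p d = ∀ k → d < k → coeff p k ≡ 0ℚ

-- Binomial coefficient polynomial:
--   binomP c m = (a + c choose m)
--              = (a+c)(a+c-1)⋯(a+c-m+1) / m!

fallingP : ℕ → ℕ → Poly
fallingP c zero    = oneP
fallingP c (suc m) = fallingP c m *P linP ((ℤ.+ c) ℚ./ 1 ℚ.- (ℤ.+ m) ℚ./ 1)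

binomP : ℕ → ℕ → Poly
binomP c m = ((ℤ.+ 1) ℚ./ (m !)) {{m !≢0}} ·P fallingP c m

-- The matrix B(n), 0-indexed: for i, j : Fin n (i = i₁ - 1, j = j₁ - 1
-- with 1-indexed i₁, j₁), the entry  binom(a + i₁ + j₁ - 2, j₁ - 1)
-- equals  binom(a + i + j, j).

B : (n : ℕ) → Fin n → Fin n → Poly
B n i j = binomP (toℕ i ℕ.+ toℕ j) (toℕ j)

sumP : (s : ℕ) → (Fin s → Poly) → Poly
sumP zero    f = []
sumP (suc s) f = f Fin.zero +P sumP s (λ j → f (Fin.suc j))

altSumP : (s : ℕ) → (Fin s → Poly) → Poly
altSumP zero    f = []
altSumP (suc s) f = f Fin.zero +P (-P altSumP s (λ j → f (Fin.suc j)))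

det : (s : ℕ) → (Fin s → Fin s → Poly) → Poly
det zero    M = oneP
det (suc s) M =
  altSumP (suc s) (λ j →
    M Fin.zero j *P det s (λ r c → M (Fin.suc r) (punchIn j c)))

-- A subset {x₁ < x₂ < ⋯ < x_s} of {1,…,n} of size s is represented by
-- its strictly increasing enumeration  Fin s → Fin n  (0-indexed).

StrictlyIncreasing : {s n : ℕ} → (Fin s → Fin n) → Set
StrictlyIncreasing {s} f = ∀ (k l : Fin s) → k Fin.< l → f k Fin.< f l

sub : {n s : ℕ} → (Fin n → Fin n → Poly) →
      (Fin s → Fin n) → (Fin s → Fin n) → Fin s → Fin s → Poly
sub M I J r c = M (I r) (J c)

-- (j₁ - 1) + (j₂ - 2) + ⋯ + (j_s - s), with 1-indexed j's.
-- With 0-indexed J k = j_{k+1} - 1 this is Σ_{k<s} (J k - k).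
sumℕ : (s : ℕ) → (Fin s → ℕ) → ℕ
sumℕ zero    f = 0
sumℕ (suc s) f = f Fin.zero ℕ.+ sumℕ s (λ k → f (Fin.suc k))

boundSum : {s n : ℕ} → (Fin s → Fin n) → ℕ
boundSum {s} J = sumℕ s (λ k → toℕ (J k) ∸ toℕ k)

module Submission where

-- For fixed j the entry binom(a+y+j, j) is, as a function of the
-- row y, annihilated by the (j+1)-st forward difference, and each forward
-- difference lowers its degree in a by one (Pascal's rule).  Newton's
-- forward-difference formula therefore writes column j as
-- Σ_{k<n} c_{jk}(a) · (binom(y,k))_y with deg c_{jk} ≤ j − k: a combination
-- of the constant vectors (binom(y,k))_y.  Expanding the determinant
-- multilinearly in the columns, a term picking vectors k_1,…,k_s vanishes
-- unless the k's are distinct (two equal columns), and then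
-- Σ k ≥ 0 + 1 + ⋯ + (s−1), so every surviving term has degree
-- ≤ Σ_j J j − Σ k ≤ Σ_j (J j − j).

open import Defs
open import Level using (0ℓ)
open import Data.Nat as ℕ using (ℕ; zero; suc; _<_; _≤_; _∸_; z≤n; s≤s; NonZero)
import Data.Nat.Properties as ℕₚ
open import Data.Nat.Properties using (_!≢0)
open import Data.Integer as ℤ using (ℤ)
import Data.Integer.Properties as ℤₚ
import Data.Integer.Tactic.RingSolver as ℤ-Solver
open import Data.Rational as ℚ using (ℚ; 0ℚ; 1ℚ; toℚᵘ)
import Data.Rational.Properties as ℚₚ
import Data.Rational.Unnormalised as ℚᵘ
import Data.Rational.Unnormalised.Properties as ℚᵘₚ
open import Data.List using ([]; _∷_)
open import Data.Maybe using (Maybe; just; nothing)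
open import Relation.Nullary.Decidable using (dec⇒maybe)
open import Data.Fin as Fin using (Fin; zero; suc; toℕ; punchIn; punchOut)
import Data.Fin.Properties as Finₚ
open import Data.Vec.Functional using (updateAt)
open import Data.Vec.Functional.Properties using (updateAt-updates; updateAt-minimal)
open import Data.Product using (Σ; _×_; _,_)
open import Data.Sum using (_⊎_; inj₁; inj₂)
open import Data.Empty using (⊥-elim)
open import Function using (_∘_)
open import Data.Fin.Permutation.Components using (transpose)
open import Relation.Binary.Definitions using (tri<; tri≈; tri>)
open import Relation.Nullary using (yes; no)
open import Relation.Binary.PropositionalEquality
  using (_≡_; _≢_; refl; sym; trans; cong; cong₂; subst; subst₂; module ≡-Reasoning)
open import Relation.Binary.Bundles using (Setoid)
open import Relation.Binary.Structures using (IsEquivalence)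
import Relation.Binary.Reasoning.Setoid as SetoidReasoning
open import Algebra.Bundles using (CommutativeRing; CommutativeMonoid)
import Algebra.Properties.CommutativeSemigroup as CommSemigroupProperties
open import Tactic.RingSolver.Core.AlmostCommutativeRing using (AlmostCommutativeRing; fromCommutativeRing)
open import Tactic.RingSolver using (solve-∀)

module ℕ+ = CommSemigroupProperties ℕₚ.+-commutativeSemigroup
module ℚ+ = CommSemigroupProperties (CommutativeMonoid.commutativeSemigroup ℚₚ.+-0-commutativeMonoid)

-- Coefficient
-- lists are not normalised (trailing zeros are allowed), so this is the
-- meaningful equality on Poly; all algebra below is up to ≈P.
infix 4 _≈P_
record _≈P_ (p q : Poly) : Set where
  constructor coeffwise
  field coeff-≡ : ∀ k → coeff p k ≡ coeff q k
open _≈P_ public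

≈P-refl : ∀ {p} → p ≈P p
≈P-refl = coeffwise λ _ → refl

≈P-reflexive : ∀ {p q} → p ≡ q → p ≈P q
≈P-reflexive refl = ≈P-refl

≈P-sym : ∀ {p q} → p ≈P q → q ≈P p
≈P-sym e = coeffwise λ k → sym (coeff-≡ e k)

≈P-trans : ∀ {p q r} → p ≈P q → q ≈P r → p ≈P r
≈P-trans e f = coeffwise λ k → trans (coeff-≡ e k) (coeff-≡ f k)

≈P-isEquivalence : IsEquivalence _≈P_
≈P-isEquivalence = record { refl = ≈P-refl ; sym = ≈P-sym ; trans = ≈P-trans }

≈P-setoid : Setoid 0ℓ 0ℓ
≈P-setoid = record { isEquivalence = ≈P-isEquivalence }

∷-cong : ∀ {c d p q} → c ≡ d → p ≈P q → (c ∷ p) ≈P (d ∷ q)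
∷-cong c≡d p≈q = coeffwise λ { zero → c≡d ; (suc k) → coeff-≡ p≈q k }

∷-injectiveʳ : ∀ {c d p q} → (c ∷ p) ≈P (d ∷ q) → p ≈P q
∷-injectiveʳ e = coeffwise λ k → coeff-≡ e (suc k)

0∷[]≈[] : (0ℚ ∷ []) ≈P []
0∷[]≈[] = coeffwise λ { zero → refl ; (suc k) → refl }

coeff-+P : ∀ p q k → coeff (p +P q) k ≡ coeff p k ℚ.+ coeff q k
coeff-+P []      q       k       = sym (ℚₚ.+-identityˡ _)
coeff-+P (c ∷ p) []      k       = sym (ℚₚ.+-identityʳ _)
coeff-+P (c ∷ p) (d ∷ q) zero    = refl
coeff-+P (c ∷ p) (d ∷ q) (suc k) = coeff-+P p q k

coeff-·P : ∀ c p k → coeff (c ·P p) k ≡ c ℚ.* coeff p k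
coeff-·P c []      k       = sym (ℚₚ.*-zeroʳ c)
coeff-·P c (d ∷ p) zero    = refl
coeff-·P c (d ∷ p) (suc k) = coeff-·P c p k

coeff--P : ∀ p k → coeff (-P p) k ≡ ℚ.- coeff p k
coeff--P []      k       = refl
coeff--P (d ∷ p) zero    = refl
coeff--P (d ∷ p) (suc k) = coeff--P p k

+P-cong : ∀ {p p′ q q′} → p ≈P p′ → q ≈P q′ → p +P q ≈P p′ +P q′
+P-cong {p} {p′} {q} {q′} e f = coeffwise λ k →
  trans (coeff-+P p q k) (trans (cong₂ ℚ._+_ (coeff-≡ e k) (coeff-≡ f k)) (sym (coeff-+P p′ q′ k)))

·P-cong : ∀ {c d p q} → c ≡ d → p ≈P q → c ·P p ≈P d ·P q
·P-cong {c} {d} {p} {q} c≡d e = coeffwise λ k →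
  trans (coeff-·P c p k) (trans (cong₂ ℚ._*_ c≡d (coeff-≡ e k)) (sym (coeff-·P d q k)))

·P-congʳ : ∀ c {p q} → p ≈P q → c ·P p ≈P c ·P q
·P-congʳ c = ·P-cong {c} refl

-P-cong : ∀ {p q} → p ≈P q → -P p ≈P -P q
-P-cong {p} {q} e = coeffwise λ k →
  trans (coeff--P p k) (trans (cong ℚ.-_ (coeff-≡ e k)) (sym (coeff--P q k)))

+P-comm : ∀ p q → p +P q ≈P q +P p
+P-comm p q = coeffwise λ k →
  trans (coeff-+P p q k) (trans (ℚₚ.+-comm (coeff p k) (coeff q k)) (sym (coeff-+P q p k)))

+P-assoc : ∀ p q r → (p +P q) +P r ≈P p +P (q +P r)
+P-assoc p q r = coeffwise λ k → begin
  coeff ((p +P q) +P r) k                  ≡⟨ coeff-+P (p +P q) r k ⟩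
  coeff (p +P q) k ℚ.+ coeff r k           ≡⟨ cong (ℚ._+ coeff r k) (coeff-+P p q k) ⟩
  (coeff p k ℚ.+ coeff q k) ℚ.+ coeff r k  ≡⟨ ℚₚ.+-assoc (coeff p k) (coeff q k) (coeff r k) ⟩
  coeff p k ℚ.+ (coeff q k ℚ.+ coeff r k)  ≡⟨ cong (coeff p k ℚ.+_) (coeff-+P q r k) ⟨
  coeff p k ℚ.+ coeff (q +P r) k           ≡⟨ coeff-+P p (q +P r) k ⟨
  coeff (p +P (q +P r)) k                  ∎
  where open ≡-Reasoning

+P-identityʳ : ∀ p → p +P [] ≈P p
+P-identityʳ []      = ≈P-refl
+P-identityʳ (c ∷ p) = ≈P-refl

-P-inverseˡ : ∀ p → (-P p) +P p ≈P []
-P-inverseˡ p = coeffwise λ k →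
  trans (coeff-+P (-P p) p k) (trans (cong (ℚ._+ coeff p k) (coeff--P p k)) (ℚₚ.+-inverseˡ (coeff p k)))

-P-inverseʳ : ∀ p → p +P (-P p) ≈P []
-P-inverseʳ p = ≈P-trans (+P-comm p (-P p)) (-P-inverseˡ p)

·P-distribˡ : ∀ c p q → c ·P (p +P q) ≈P (c ·P p) +P (c ·P q)
·P-distribˡ c p q = coeffwise λ k → begin
  coeff (c ·P (p +P q)) k                       ≡⟨ coeff-·P c (p +P q) k ⟩
  c ℚ.* coeff (p +P q) k                        ≡⟨ cong (c ℚ.*_) (coeff-+P p q k) ⟩
  c ℚ.* (coeff p k ℚ.+ coeff q k)               ≡⟨ ℚₚ.*-distribˡ-+ c (coeff p k) (coeff q k) ⟩
  c ℚ.* coeff p k ℚ.+ c ℚ.* coeff q k           ≡⟨ cong₂ ℚ._+_ (coeff-·P c p k) (coeff-·P c q k) ⟨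
  coeff (c ·P p) k ℚ.+ coeff (c ·P q) k         ≡⟨ coeff-+P (c ·P p) (c ·P q) k ⟨
  coeff ((c ·P p) +P (c ·P q)) k                ∎
  where open ≡-Reasoning

·P-distribʳ : ∀ c d p → (c ℚ.+ d) ·P p ≈P (c ·P p) +P (d ·P p)
·P-distribʳ c d p = coeffwise λ k → begin
  coeff ((c ℚ.+ d) ·P p) k                      ≡⟨ coeff-·P (c ℚ.+ d) p k ⟩
  (c ℚ.+ d) ℚ.* coeff p k                       ≡⟨ ℚₚ.*-distribʳ-+ (coeff p k) c d ⟩
  c ℚ.* coeff p k ℚ.+ d ℚ.* coeff p k           ≡⟨ cong₂ ℚ._+_ (coeff-·P c p k) (coeff-·P d p k) ⟨
  coeff (c ·P p) k ℚ.+ coeff (d ·P p) k         ≡⟨ coeff-+P (c ·P p) (d ·P p) k ⟨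
  coeff ((c ·P p) +P (d ·P p)) k                ∎
  where open ≡-Reasoning

·P-assoc : ∀ c d p → (c ℚ.* d) ·P p ≈P c ·P (d ·P p)
·P-assoc c d p = coeffwise λ k →
  trans (coeff-·P (c ℚ.* d) p k) (trans (ℚₚ.*-assoc c d (coeff p k))
    (sym (trans (coeff-·P c (d ·P p) k) (cong (c ℚ.*_) (coeff-·P d p k)))))

·P-zeroˡ : ∀ p → 0ℚ ·P p ≈P []
·P-zeroˡ p = coeffwise λ k → trans (coeff-·P 0ℚ p k) (ℚₚ.*-zeroˡ (coeff p k))

·P-identityˡ : ∀ p → 1ℚ ·P p ≈P p
·P-identityˡ p = coeffwise λ k → trans (coeff-·P 1ℚ p k) (ℚₚ.*-identityˡ (coeff p k))

*P-zeroˡ : ∀ p q → p ≈P [] → p *P q ≈P []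
*P-zeroˡ []      q e = ≈P-refl
*P-zeroˡ (c ∷ p) q e =
  ≈P-trans (+P-cong (≈P-trans (·P-cong (coeff-≡ e zero) ≈P-refl) (·P-zeroˡ q))
                    (∷-cong refl (*P-zeroˡ p q (coeffwise λ k → coeff-≡ e (suc k)))))
           0∷[]≈[]

*P-zeroʳ : ∀ p → p *P [] ≈P []
*P-zeroʳ []      = ≈P-refl
*P-zeroʳ (c ∷ p) = ≈P-trans (∷-cong refl (*P-zeroʳ p)) 0∷[]≈[]

*P-congˡ : ∀ {p p′} q → p ≈P p′ → p *P q ≈P p′ *P q
*P-congˡ {[]}    {p′}      q e = ≈P-sym (*P-zeroˡ p′ q (≈P-sym e))
*P-congˡ {c ∷ p} {[]}      q e = *P-zeroˡ (c ∷ p) q e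
*P-congˡ {c ∷ p} {c′ ∷ p′} q e =
  +P-cong (·P-cong (coeff-≡ e zero) ≈P-refl) (∷-cong refl (*P-congˡ q (∷-injectiveʳ e)))

*P-congʳ : ∀ p {q q′} → q ≈P q′ → p *P q ≈P p *P q′
*P-congʳ []      e = ≈P-refl
*P-congʳ (c ∷ p) e = +P-cong (·P-congʳ c e) (∷-cong refl (*P-congʳ p e))

*P-cong : ∀ {p p′ q q′} → p ≈P p′ → q ≈P q′ → p *P q ≈P p′ *P q′
*P-cong {p′ = p′} {q = q} e f = ≈P-trans (*P-congˡ q e) (*P-congʳ p′ f)

+P-interchange : ∀ p q r t → (p +P q) +P (r +P t) ≈P (p +P r) +P (q +P t)
+P-interchange p q r t = coeffwise λ k → begin
  coeff ((p +P q) +P (r +P t)) k                                 ≡⟨ coeff-+P (p +P q) (r +P t) k ⟩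
  coeff (p +P q) k ℚ.+ coeff (r +P t) k                          ≡⟨ cong₂ ℚ._+_ (coeff-+P p q k) (coeff-+P r t k) ⟩
  (coeff p k ℚ.+ coeff q k) ℚ.+ (coeff r k ℚ.+ coeff t k)        ≡⟨ ℚ+.interchange (coeff p k) (coeff q k) (coeff r k) (coeff t k) ⟩
  (coeff p k ℚ.+ coeff r k) ℚ.+ (coeff q k ℚ.+ coeff t k)        ≡⟨ cong₂ ℚ._+_ (coeff-+P p r k) (coeff-+P q t k) ⟨
  coeff (p +P r) k ℚ.+ coeff (q +P t) k                          ≡⟨ coeff-+P (p +P r) (q +P t) k ⟨
  coeff ((p +P r) +P (q +P t)) k                                 ∎
  where open ≡-Reasoning

*P-distribʳ : ∀ p q r → (p +P q) *P r ≈P (p *P r) +P (q *P r)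
*P-distribʳ []      q       r = ≈P-refl
*P-distribʳ (c ∷ p) []      r = ≈P-sym (+P-identityʳ _)
*P-distribʳ (c ∷ p) (d ∷ q) r =
  ≈P-trans (+P-cong (·P-distribʳ c d r) (∷-cong (sym (ℚₚ.+-identityˡ 0ℚ)) (*P-distribʳ p q r)))
           (+P-interchange (c ·P r) (d ·P r) (0ℚ ∷ (p *P r)) (0ℚ ∷ (q *P r)))

·P-*P : ∀ c p q → (c ·P p) *P q ≈P c ·P (p *P q)
·P-*P c []      q = ≈P-refl
·P-*P c (d ∷ p) q =
  ≈P-trans (+P-cong (·P-assoc c d q) (∷-cong (sym (ℚₚ.*-zeroʳ c)) (·P-*P c p q)))
           (≈P-sym (·P-distribˡ c (d ·P q) (0ℚ ∷ (p *P q))))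

0∷-*P : ∀ p q → (0ℚ ∷ p) *P q ≈P 0ℚ ∷ (p *P q)
0∷-*P p q = +P-cong (·P-zeroˡ q) ≈P-refl

*P-assoc : ∀ p q r → (p *P q) *P r ≈P p *P (q *P r)
*P-assoc []      q r = ≈P-refl
*P-assoc (c ∷ p) q r =
  ≈P-trans (*P-distribʳ (c ·P q) (0ℚ ∷ (p *P q)) r)
           (+P-cong (·P-*P c q r) (≈P-trans (0∷-*P (p *P q) r) (∷-cong refl (*P-assoc p q r))))

*P-∷ : ∀ q c p → q *P (c ∷ p) ≈P (c ·P q) +P (0ℚ ∷ (q *P p))
*P-∷ []      c p = ≈P-sym (≈P-trans (+P-identityʳ (0ℚ ∷ [])) 0∷[]≈[])
*P-∷ (d ∷ q) c p = ∷-cong (cong (ℚ._+ 0ℚ) (ℚₚ.*-comm d c)) (begin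
  (d ·P p) +P (q *P (c ∷ p))                        ≈⟨ +P-cong (≈P-refl {d ·P p}) (*P-∷ q c p) ⟩
  (d ·P p) +P ((c ·P q) +P (0ℚ ∷ (q *P p)))         ≈⟨ +P-cong (≈P-refl {d ·P p}) (+P-comm (c ·P q) (0ℚ ∷ (q *P p))) ⟩
  (d ·P p) +P ((0ℚ ∷ (q *P p)) +P (c ·P q))         ≈⟨ +P-assoc (d ·P p) (0ℚ ∷ (q *P p)) (c ·P q) ⟨
  ((d ·P p) +P (0ℚ ∷ (q *P p))) +P (c ·P q)         ≈⟨ +P-comm _ (c ·P q) ⟩
  (c ·P q) +P ((d ∷ q) *P p)                        ∎)
  where open SetoidReasoning ≈P-setoid

*P-comm : ∀ p q → p *P q ≈P q *P p
*P-comm []      q = ≈P-sym (*P-zeroʳ q)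
*P-comm (c ∷ p) q = ≈P-trans (+P-cong ≈P-refl (∷-cong refl (*P-comm p q))) (≈P-sym (*P-∷ q c p))

*P-distribˡ : ∀ p q r → p *P (q +P r) ≈P (p *P q) +P (p *P r)
*P-distribˡ p q r =
  ≈P-trans (*P-comm p (q +P r)) (≈P-trans (*P-distribʳ q r p) (+P-cong (*P-comm q p) (*P-comm r p)))

*P-identityˡ : ∀ p → oneP *P p ≈P p
*P-identityˡ p = ≈P-trans (+P-cong (·P-identityˡ p) 0∷[]≈[]) (+P-identityʳ p)

*P-identityʳ : ∀ p → p *P oneP ≈P p
*P-identityʳ p = ≈P-trans (*P-comm p oneP) (*P-identityˡ p)

polyRing : CommutativeRing 0ℓ 0ℓ
polyRing = record
  { Carrier = Poly ; _≈_ = _≈P_ ; _+_ = _+P_ ; _*_ = _*P_ ; -_ = -P_ ; 0# = [] ; 1# = oneP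
  ; isCommutativeRing = record
    { isRing = record
      { +-isAbelianGroup = record
        { isGroup = record
          { isMonoid = record
            { isSemigroup = record
              { isMagma = record { isEquivalence = ≈P-isEquivalence ; ∙-cong = +P-cong }
              ; assoc = +P-assoc }
            ; identity = (λ _ → ≈P-refl) , +P-identityʳ }
          ; inverse = -P-inverseˡ , -P-inverseʳ
          ; ⁻¹-cong = -P-cong }
        ; comm = +P-comm }
      ; *-cong = *P-cong
      ; *-assoc = *P-assoc
      ; *-identity = *P-identityˡ , *P-identityʳ
      ; distrib = *P-distribˡ , (λ p q r → *P-distribʳ q r p) }
    ; *-comm = *P-comm } }

-- Recognising the zero polynomial, which lets the ring solver cancel
-- terms such as x − x.
zero? : ∀ p → Maybe ([] ≈P p)
zero? []      = just ≈P-refl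
zero? (c ∷ p) with 0ℚ ℚₚ.≟ c | zero? p
... | yes 0≡c | just []≈p = just (coeffwise λ { zero → 0≡c ; (suc k) → coeff-≡ []≈p k })
... | _       | _         = nothing

polyRing′ : AlmostCommutativeRing 0ℓ 0ℓ
polyRing′ = fromCommutativeRing polyRing zero?

ℕ→ℚ : ℕ → ℚ
ℕ→ℚ n = (ℤ.+ n) ℚ./ 1

1/_! : ℕ → ℚ
1/ m ! = ((ℤ.+ 1) ℚ./ (m ℕ.!)) {{m !≢0}}

ℚ-ring : AlmostCommutativeRing 0ℓ 0ℓ
ℚ-ring = fromCommutativeRing ℚₚ.+-*-commutativeRing (λ x → dec⇒maybe (0ℚ ℚₚ.≟ x))

toℚᵘ-/ : ∀ i n .{{_ : NonZero n}} → toℚᵘ (i ℚ./ n) ℚᵘ.≃ (i ℚᵘ./ n)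
toℚᵘ-/ i (suc d) = ℚₚ.toℚᵘ-fromℚᵘ (ℚᵘ.mkℚᵘ i d)

ℕ→ℚ-suc : ∀ n → ℕ→ℚ (suc n) ≡ 1ℚ ℚ.+ ℕ→ℚ n
ℕ→ℚ-suc n = ℚₚ.toℚᵘ-injective (begin
  toℚᵘ (ℕ→ℚ (suc n))                         ≈⟨ toℚᵘ-/ (ℤ.+ suc n) 1 ⟩
  ℤ.+ suc n ℚᵘ./ 1                           ≈⟨ ℚᵘ.*≡* cross-multiplied ⟩
  ℚᵘ.1ℚᵘ ℚᵘ.+ (ℤ.+ n ℚᵘ./ 1)                 ≈⟨ ℚᵘₚ.+-congʳ ℚᵘ.1ℚᵘ (toℚᵘ-/ (ℤ.+ n) 1) ⟨
  toℚᵘ 1ℚ ℚᵘ.+ toℚᵘ (ℕ→ℚ n)                  ≈⟨ ℚₚ.toℚᵘ-homo-+ 1ℚ (ℕ→ℚ n) ⟨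
  toℚᵘ (1ℚ ℚ.+ ℕ→ℚ n)                        ∎)
  where
  open ℚᵘₚ.≃-Reasoning
  regroup : ∀ x → (ℤ.+ 1 ℤ.+ x) ℤ.* ℤ.+ 1 ≡ (ℤ.+ 1 ℤ.* ℤ.+ 1 ℤ.+ x ℤ.* ℤ.+ 1) ℤ.* ℤ.+ 1
  regroup = ℤ-Solver.solve-∀
  cross-multiplied : ℤ.+ suc n ℤ.* ℤ.+ 1 ≡ (ℤ.+ 1 ℤ.* ℤ.+ 1 ℤ.+ ℤ.+ n ℤ.* ℤ.+ 1) ℤ.* ℤ.+ 1
  cross-multiplied = trans (cong (ℤ._* ℤ.+ 1) (ℤₚ.pos-+ 1 n)) (regroup (ℤ.+ n))

1/[k*d]*k≃1/d : ∀ k d .{{_ : NonZero k}} .{{_ : NonZero d}} →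
  ((ℤ.+ 1) ℚᵘ./ (k ℕ.* d)) {{ℕₚ.m*n≢0 k d}} ℚᵘ.* ((ℤ.+ k) ℚᵘ./ 1) ℚᵘ.≃ (ℤ.+ 1) ℚᵘ./ d
1/[k*d]*k≃1/d (suc k) (suc d) = ℚᵘ.*≡* (trans (regroup (ℤ.+ suc k) (ℤ.+ suc d))
  (cong (λ z → ℤ.+ 1 ℤ.* (z ℤ.* ℤ.+ 1)) (sym (ℤₚ.pos-* (suc k) (suc d)))))
  where
  regroup : ∀ x y → ℤ.+ 1 ℤ.* x ℤ.* y ≡ ℤ.+ 1 ℤ.* ((x ℤ.* y) ℤ.* ℤ.+ 1)
  regroup = ℤ-Solver.solve-∀

1/!-suc : ∀ m → 1/ suc m ! ℚ.* ℕ→ℚ (suc m) ≡ 1/ m !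
1/!-suc m = ℚₚ.toℚᵘ-injective (begin
  toℚᵘ (1/ suc m ! ℚ.* ℕ→ℚ (suc m))
    ≈⟨ ℚₚ.toℚᵘ-homo-* (1/ suc m !) (ℕ→ℚ (suc m)) ⟩
  toℚᵘ (1/ suc m !) ℚᵘ.* toℚᵘ (ℕ→ℚ (suc m))
    ≈⟨ ℚᵘₚ.*-cong (toℚᵘ-/ (ℤ.+ 1) (suc m ℕ.!) {{suc m !≢0}}) (toℚᵘ-/ (ℤ.+ suc m) 1) ⟩
  (ℤ.+ 1 ℚᵘ./ (suc m ℕ.!)) {{suc m !≢0}} ℚᵘ.* (ℤ.+ suc m ℚᵘ./ 1)
    ≈⟨ 1/[k*d]*k≃1/d (suc m) (m ℕ.!) {{_}} {{m !≢0}} ⟩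
  (ℤ.+ 1 ℚᵘ./ (m ℕ.!)) {{m !≢0}}
    ≈⟨ toℚᵘ-/ (ℤ.+ 1) (m ℕ.!) {{m !≢0}} ⟨
  toℚᵘ (1/ m !)
    ∎)
  where open ℚᵘₚ.≃-Reasoning

ℕ→ℚ-suc-∸ : ∀ c m → ℕ→ℚ (suc c) ℚ.- ℕ→ℚ (suc m) ≡ ℕ→ℚ c ℚ.- ℕ→ℚ m
ℕ→ℚ-suc-∸ c m = trans (cong₂ ℚ._-_ (ℕ→ℚ-suc c) (ℕ→ℚ-suc m)) (cancel-1 (ℕ→ℚ c) (ℕ→ℚ m))
  where
  cancel-1 : ∀ x y → (1ℚ ℚ.+ x) ℚ.- (1ℚ ℚ.+ y) ≡ x ℚ.- y
  cancel-1 = solve-∀ ℚ-ring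

ℕ→ℚ-suc-split : ∀ c m → ℕ→ℚ (suc c) ≡ (ℕ→ℚ c ℚ.- ℕ→ℚ m) ℚ.+ ℕ→ℚ (suc m)
ℕ→ℚ-suc-split c m =
  trans (ℕ→ℚ-suc c) (trans (split (ℕ→ℚ c) (ℕ→ℚ m)) (cong ((ℕ→ℚ c ℚ.- ℕ→ℚ m) ℚ.+_) (sym (ℕ→ℚ-suc m))))
  where
  split : ∀ x y → 1ℚ ℚ.+ x ≡ (x ℚ.- y) ℚ.+ (1ℚ ℚ.+ y)
  split = solve-∀ ℚ-ring

constP-*P : ∀ c p → constP c *P p ≈P c ·P p
constP-*P c p = ≈P-trans (+P-cong (≈P-refl {c ·P p}) 0∷[]≈[]) (+P-identityʳ (c ·P p))

fallingP-suc : ∀ c m → fallingP (suc c) (suc m) ≈P linP (ℕ→ℚ (suc c)) *P fallingP c m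
fallingP-suc c zero = begin
  oneP *P linP (ℕ→ℚ (suc c) ℚ.- ℕ→ℚ 0)     ≈⟨ *P-identityˡ (linP (ℕ→ℚ (suc c) ℚ.- ℕ→ℚ 0)) ⟩
  linP (ℕ→ℚ (suc c) ℚ.- 0ℚ)                ≡⟨ cong linP (ℚₚ.+-identityʳ (ℕ→ℚ (suc c))) ⟩
  linP (ℕ→ℚ (suc c))                       ≈⟨ *P-identityʳ (linP (ℕ→ℚ (suc c))) ⟨
  linP (ℕ→ℚ (suc c)) *P oneP               ∎
  where open SetoidReasoning ≈P-setoid
fallingP-suc c (suc m) = begin
  fallingP (suc c) (suc m) *P linP (ℕ→ℚ (suc c) ℚ.- ℕ→ℚ (suc m))
    ≈⟨ *P-cong (fallingP-suc c m) (≈P-reflexive (cong linP (ℕ→ℚ-suc-∸ c m))) ⟩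
  (linP (ℕ→ℚ (suc c)) *P fallingP c m) *P linP (ℕ→ℚ c ℚ.- ℕ→ℚ m)
    ≈⟨ *P-assoc (linP (ℕ→ℚ (suc c))) (fallingP c m) (linP (ℕ→ℚ c ℚ.- ℕ→ℚ m)) ⟩
  linP (ℕ→ℚ (suc c)) *P fallingP c (suc m) ∎
  where open SetoidReasoning ≈P-setoid

-- Pascal's rule  binom(a+c+1, m+1) = binom(a+c, m+1) + binom(a+c, m):
-- split the factor a+c+1 of the falling factorial as (a+c−m) + (m+1).
pascal : ∀ c m → binomP (suc c) (suc m) ≈P binomP c (suc m) +P binomP c m
pascal c m = begin
  α ·P fallingP (suc c) (suc m)            ≈⟨ ·P-congʳ α (fallingP-suc c m) ⟩
  α ·P (linP (ℕ→ℚ (suc c)) *P F)           ≡⟨ cong (λ x → α ·P (linP x *P F)) (ℕ→ℚ-suc-split c m) ⟩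
  α ·P ((L +P C) *P F)                     ≈⟨ ·P-congʳ α (*P-distribʳ L C F) ⟩
  α ·P ((L *P F) +P (C *P F))              ≈⟨ ·P-distribˡ α (L *P F) (C *P F) ⟩
  (α ·P (L *P F)) +P (α ·P (C *P F))       ≈⟨ +P-cong (·P-congʳ α (*P-comm L F)) (·P-congʳ α (constP-*P (ℕ→ℚ (suc m)) F)) ⟩
  (α ·P (F *P L)) +P (α ·P (ℕ→ℚ (suc m) ·P F))
                                           ≈⟨ +P-cong (≈P-refl {binomP c (suc m)}) (≈P-sym (·P-assoc α (ℕ→ℚ (suc m)) F)) ⟩
  binomP c (suc m) +P ((α ℚ.* ℕ→ℚ (suc m)) ·P F)
                                           ≈⟨ +P-cong (≈P-refl {binomP c (suc m)}) (·P-cong (1/!-suc m) ≈P-refl) ⟩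
  binomP c (suc m) +P binomP c m           ∎
  where
  open SetoidReasoning ≈P-setoid
  α : ℚ
  α = 1/ suc m !
  F L C : Poly
  F = fallingP c m
  L = linP (ℕ→ℚ c ℚ.- ℕ→ℚ m)
  C = constP (ℕ→ℚ (suc m))

-- DegAtMost p d e  means  deg p ≤ d − e  as integers: the coefficient of
-- aᵏ vanishes as soon as k + e > d (if e > d, p ≈P 0).  The shift e lets
-- the bound deg Δᵏgⱼ ≤ j − k below be stated without truncated
-- subtraction, and makes bounds add up under multiplication.
record DegAtMost (p : Poly) (d e : ℕ) : Set where
  constructor degAtMost
  field vanishes : ∀ k → d < k ℕ.+ e → coeff p k ≡ 0ℚ
open DegAtMost public

deg-weaken : ∀ {p d e d′ e′} → d ℕ.+ e′ ≤ d′ ℕ.+ e → DegAtMost p d e → DegAtMost p d′ e′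
deg-weaken {p} {d} {e} {d′} {e′} d+e′≤d′+e deg = degAtMost λ k d′<k+e′ →
  vanishes deg k (ℕₚ.+-cancelʳ-< e′ d (k ℕ.+ e) (begin-strict
    d ℕ.+ e′          ≤⟨ d+e′≤d′+e ⟩
    d′ ℕ.+ e          <⟨ ℕₚ.+-monoˡ-< e d′<k+e′ ⟩
    k ℕ.+ e′ ℕ.+ e    ≡⟨ ℕ+.xy∙z≈xz∙y k e′ e ⟩
    k ℕ.+ e ℕ.+ e′    ∎))
  where open ℕₚ.≤-Reasoning

deg-cong : ∀ {p q d e} → p ≈P q → DegAtMost p d e → DegAtMost q d e
deg-cong p≈q deg = degAtMost λ k lt → trans (sym (coeff-≡ p≈q k)) (vanishes deg k lt)

deg-zero : ∀ {p} d e → p ≈P [] → DegAtMost p d e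
deg-zero d e p≈0 = degAtMost λ k _ → coeff-≡ p≈0 k

deg-negative : ∀ {p d e} → d < e → DegAtMost p d e → p ≈P []
deg-negative {e = e} d<e deg = coeffwise λ k → vanishes deg k (ℕₚ.<-≤-trans d<e (ℕₚ.m≤n+m e k))

deg-+P : ∀ {p q d e} → DegAtMost p d e → DegAtMost q d e → DegAtMost (p +P q) d e
deg-+P {p} {q} dp dq = degAtMost λ k lt →
  trans (coeff-+P p q k) (trans (cong₂ ℚ._+_ (vanishes dp k lt) (vanishes dq k lt)) (ℚₚ.+-identityˡ 0ℚ))

deg--P : ∀ {p d e} → DegAtMost p d e → DegAtMost (-P p) d e
deg--P {p} dp = degAtMost λ k lt → trans (coeff--P p k) (cong ℚ.-_ (vanishes dp k lt))

deg-·P : ∀ c {p d e} → DegAtMost p d e → DegAtMost (c ·P p) d e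
deg-·P c {p} dp = degAtMost λ k lt →
  trans (coeff-·P c p k) (trans (cong (c ℚ.*_) (vanishes dp k lt)) (ℚₚ.*-zeroʳ c))

-- Induction on the left factor
-- c ∷ p, whose product is c·q + a·(p*q): either the constant c vanishes
-- (when the bound for c ∷ p is negative) or c·q obeys the bound of q.
deg-*P : ∀ {p q d₁ e₁ d₂ e₂} → DegAtMost p d₁ e₁ → DegAtMost q d₂ e₂ →
         DegAtMost (p *P q) (d₁ ℕ.+ d₂) (e₁ ℕ.+ e₂)
deg-*P {[]}    dp dq = deg-zero _ _ ≈P-refl
deg-*P {c ∷ p} {q} {d₁} {e₁} {d₂} {e₂} dp dq = deg-+P head-term shifted-term
  where
  tail-deg : DegAtMost p d₁ (suc e₁)
  tail-deg = degAtMost λ k lt → vanishes dp (suc k) (subst (d₁ <_) (ℕₚ.+-suc k e₁) lt)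
  shifted-term : DegAtMost (0ℚ ∷ (p *P q)) (d₁ ℕ.+ d₂) (e₁ ℕ.+ e₂)
  shifted-term = degAtMost λ
    { zero    _  → refl
    ; (suc k) lt → vanishes (deg-*P tail-deg dq) k (subst (d₁ ℕ.+ d₂ <_) (sym (ℕₚ.+-suc k (e₁ ℕ.+ e₂))) lt) }
  head-term : DegAtMost (c ·P q) (d₁ ℕ.+ d₂) (e₁ ℕ.+ e₂)
  head-term with d₁ ℕ.<? e₁
  ... | yes d₁<e₁ = deg-zero _ _ (≈P-trans (·P-cong (vanishes dp 0 d₁<e₁) ≈P-refl) (·P-zeroˡ q))
  ... | no  d₁≮e₁ = deg-·P c (deg-weaken bound dq)
    where
    bound : d₂ ℕ.+ (e₁ ℕ.+ e₂) ≤ (d₁ ℕ.+ d₂) ℕ.+ e₂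
    bound = subst₂ _≤_ (ℕ+.xy∙z≈x∙zy d₂ e₂ e₁) (ℕ+.xy∙z≈zx∙y d₂ e₂ d₁)
                       (ℕₚ.+-monoʳ-≤ (d₂ ℕ.+ e₂) (ℕₚ.≮⇒≥ d₁≮e₁))

deg-oneP : DegAtMost oneP 0 0
deg-oneP = degAtMost λ { zero () ; (suc k) _ → refl }

deg-linP : ∀ c → DegAtMost (linP c) 1 0
deg-linP c = degAtMost λ { zero () ; (suc zero) (s≤s ()) ; (suc (suc k)) _ → refl }

deg-fallingP : ∀ c m → DegAtMost (fallingP c m) m 0
deg-fallingP c zero    = deg-oneP
deg-fallingP c (suc m) = subst (λ d → DegAtMost (fallingP c (suc m)) d 0) (ℕₚ.+-comm m 1)
  (deg-*P (deg-fallingP c m) (deg-linP _))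

deg-binomP : ∀ c m → DegAtMost (binomP c m) m 0
deg-binomP c m = deg-·P (1/ m !) (deg-fallingP c m)

sumP-cong : ∀ N {f g : Fin N → Poly} → (∀ k → f k ≈P g k) → sumP N f ≈P sumP N g
sumP-cong zero    f≈g = ≈P-refl
sumP-cong (suc N) f≈g = +P-cong (f≈g zero) (sumP-cong N (λ k → f≈g (suc k)))

altSumP-cong : ∀ N {f g : Fin N → Poly} → (∀ k → f k ≈P g k) → altSumP N f ≈P altSumP N g
altSumP-cong zero    f≈g = ≈P-refl
altSumP-cong (suc N) f≈g = +P-cong (f≈g zero) (-P-cong (altSumP-cong N (λ k → f≈g (suc k))))

sumP-zero : ∀ N {f : Fin N → Poly} → (∀ k → f k ≈P []) → sumP N f ≈P []
sumP-zero zero    f≈0 = ≈P-refl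
sumP-zero (suc N) f≈0 = +P-cong (f≈0 zero) (sumP-zero N (λ k → f≈0 (suc k)))

altSumP-zero : ∀ N {f : Fin N → Poly} → (∀ k → f k ≈P []) → altSumP N f ≈P []
altSumP-zero zero    f≈0 = ≈P-refl
altSumP-zero (suc N) f≈0 = +P-cong (f≈0 zero) (-P-cong (altSumP-zero N (λ k → f≈0 (suc k))))

sumP-+P : ∀ N (f g : Fin N → Poly) → sumP N (λ j → f j +P g j) ≈P sumP N f +P sumP N g
sumP-+P zero    f g = ≈P-refl
sumP-+P (suc N) f g =
  ≈P-trans (+P-cong (≈P-refl {f zero +P g zero}) (sumP-+P N (λ j → f (suc j)) (λ j → g (suc j))))
           (+P-interchange (f zero) (g zero) (sumP N (λ j → f (suc j))) (sumP N (λ j → g (suc j))))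

altSumP-+P : ∀ N (f g : Fin N → Poly) → altSumP N (λ j → f j +P g j) ≈P altSumP N f +P altSumP N g
altSumP-+P zero    f g = ≈P-refl
altSumP-+P (suc N) f g =
  ≈P-trans (+P-cong (≈P-refl {f zero +P g zero}) (-P-cong (altSumP-+P N (λ j → f (suc j)) (λ j → g (suc j)))))
           (regroup (f zero) (g zero) (altSumP N (λ j → f (suc j))) (altSumP N (λ j → g (suc j))))
  where
  regroup : ∀ a b x y → (a +P b) +P (-P (x +P y)) ≈P (a +P (-P x)) +P (b +P (-P y))
  regroup = solve-∀ polyRing′

altSumP--P : ∀ N (f : Fin N → Poly) → altSumP N (λ j → -P f j) ≈P -P altSumP N f
altSumP--P zero    f = ≈P-refl
altSumP--P (suc N) f =
  ≈P-trans (+P-cong (≈P-refl { -P f zero}) (-P-cong (altSumP--P N (λ j → f (suc j)))))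
           (regroup (f zero) (altSumP N (λ j → f (suc j))))
  where
  regroup : ∀ a x → (-P a) +P (-P (-P x)) ≈P -P (a +P (-P x))
  regroup = solve-∀ polyRing′

sumP-*ˡ : ∀ N p (f : Fin N → Poly) → p *P sumP N f ≈P sumP N (λ j → p *P f j)
sumP-*ˡ zero    p f = *P-zeroʳ p
sumP-*ˡ (suc N) p f =
  ≈P-trans (*P-distribˡ p (f zero) (sumP N (λ j → f (suc j))))
           (+P-cong (≈P-refl {p *P f zero}) (sumP-*ˡ N p (λ j → f (suc j))))

sumP-*ʳ : ∀ N p (f : Fin N → Poly) → sumP N f *P p ≈P sumP N (λ j → f j *P p)
sumP-*ʳ N p f =
  ≈P-trans (*P-comm (sumP N f) p) (≈P-trans (sumP-*ˡ N p f) (sumP-cong N (λ j → *P-comm p (f j))))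

altSumP-*ˡ : ∀ N p (f : Fin N → Poly) → altSumP N (λ j → p *P f j) ≈P p *P altSumP N f
altSumP-*ˡ zero    p f = ≈P-sym (*P-zeroʳ p)
altSumP-*ˡ (suc N) p f =
  ≈P-trans (+P-cong (≈P-refl {p *P f zero}) (-P-cong (altSumP-*ˡ N p (λ j → f (suc j)))))
           (≈P-sym (distrib p (f zero) (altSumP N (λ j → f (suc j)))))
  where
  distrib : ∀ p a x → p *P (a +P (-P x)) ≈P (p *P a) +P (-P (p *P x))
  distrib = solve-∀ polyRing′

altSumP-sumP : ∀ S N (F : Fin N → Fin S → Poly) →
               altSumP S (λ j → sumP N (λ k → F k j)) ≈P sumP N (λ k → altSumP S (F k))
altSumP-sumP S zero    F = altSumP-zero S (λ _ → ≈P-refl)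
altSumP-sumP S (suc N) F =
  ≈P-trans (altSumP-+P S (F zero) (λ j → sumP N (λ k → F (suc k) j)))
           (+P-cong (≈P-refl {altSumP S (F zero)}) (altSumP-sumP S N (λ k → F (suc k))))

deg-sumP : ∀ {d e} N (f : Fin N → Poly) → (∀ k → DegAtMost (f k) d e) → DegAtMost (sumP N f) d e
deg-sumP zero    f deg = deg-zero _ _ ≈P-refl
deg-sumP (suc N) f deg = deg-+P (deg zero) (deg-sumP N (λ k → f (suc k)) (λ k → deg (suc k)))

deg-altSumP : ∀ {d e} N (f : Fin N → Poly) → (∀ k → DegAtMost (f k) d e) → DegAtMost (altSumP N f) d e
deg-altSumP zero    f deg = deg-zero _ _ ≈P-refl
deg-altSumP (suc N) f deg =
  deg-+P (deg zero) (deg--P (deg-altSumP N (λ k → f (suc k)) (λ k → deg (suc k))))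

Matrix : ℕ → Set
Matrix s = Fin s → Fin s → Poly

minor : ∀ {s} → Fin (suc s) → Matrix (suc s) → Matrix s
minor j M r c = M (suc r) (punchIn j c)

det-cong : ∀ s {M M′ : Matrix s} → (∀ r c → M r c ≈P M′ r c) → det s M ≈P det s M′
det-cong zero    M≈M′ = ≈P-refl
det-cong (suc s) M≈M′ =
  altSumP-cong (suc s) (λ j → *P-cong (M≈M′ zero j) (det-cong s (λ r c → M≈M′ (suc r) (punchIn j c))))

deg-det-const : ∀ s (M : Matrix s) → (∀ r c → DegAtMost (M r c) 0 0) → DegAtMost (det s M) 0 0
deg-det-const zero    M const = deg-oneP
deg-det-const (suc s) M const = deg-altSumP (suc s) _ λ j →
  deg-*P (const zero j) (deg-det-const s (minor j M) (λ r c → const (suc r) (punchIn j c)))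

-- Induction along the Laplace expansion: the
-- term j = c₀ is linear in the entry M 0 c₀, the other terms are linear
-- in the minor by induction.
det-linear : ∀ s (M : Matrix s) N (β : Fin N → Poly) (Ms : Fin N → Matrix s) (c₀ : Fin s) →
             (∀ k r c → c ≢ c₀ → M r c ≈P Ms k r c) →
             (∀ r → M r c₀ ≈P sumP N (λ k → β k *P Ms k r c₀)) →
             det s M ≈P sumP N (λ k → β k *P det s (Ms k))
det-linear (suc s) M N β Ms c₀ same-off-c₀ column-c₀ = begin
  altSumP (suc s) (λ j → M zero j *P det s (minor j M))     ≈⟨ altSumP-cong (suc s) expand-term ⟩
  altSumP (suc s) (λ j → sumP N (λ k → β k *P term k j))    ≈⟨ altSumP-sumP (suc s) N (λ k j → β k *P term k j) ⟩
  sumP N (λ k → altSumP (suc s) (λ j → β k *P term k j))    ≈⟨ sumP-cong N (λ k → altSumP-*ˡ (suc s) (β k) (term k)) ⟩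
  sumP N (λ k → β k *P det (suc s) (Ms k))                  ∎
  where
  open SetoidReasoning ≈P-setoid
  term : Fin N → Fin (suc s) → Poly
  term k j = Ms k zero j *P det s (minor j (Ms k))
  swap-factors : ∀ a b c → a *P (b *P c) ≈P b *P (a *P c)
  swap-factors = solve-∀ polyRing′
  expand-term : ∀ j → M zero j *P det s (minor j M) ≈P sumP N (λ k → β k *P term k j)
  expand-term j with j Fin.≟ c₀
  ... | yes refl = begin
    M zero j *P det s (minor j M)                              ≈⟨ *P-congˡ _ (column-c₀ zero) ⟩
    sumP N (λ k → β k *P Ms k zero j) *P det s (minor j M)     ≈⟨ sumP-*ʳ N _ (λ k → β k *P Ms k zero j) ⟩
    sumP N (λ k → (β k *P Ms k zero j) *P det s (minor j M))   ≈⟨ sumP-cong N (λ k → *P-assoc (β k) _ _) ⟩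
    sumP N (λ k → β k *P (Ms k zero j *P det s (minor j M)))   ≈⟨ sumP-cong N (λ k → *P-congʳ (β k) (*P-congʳ (Ms k zero j) (minor-same k))) ⟩
    sumP N (λ k → β k *P term k j)                             ∎
    where
    minor-same : ∀ k → det s (minor j M) ≈P det s (minor j (Ms k))
    minor-same k = det-cong s (λ r c → same-off-c₀ k (suc r) (punchIn j c) (Finₚ.punchInᵢ≢i j c))
  ... | no j≢c₀ = begin
    M zero j *P det s (minor j M)                              ≈⟨ *P-congʳ (M zero j) minor-linear ⟩
    M zero j *P sumP N (λ k → β k *P det s (minor j (Ms k)))   ≈⟨ sumP-*ˡ N (M zero j) _ ⟩
    sumP N (λ k → M zero j *P (β k *P det s (minor j (Ms k)))) ≈⟨ sumP-cong N (λ k → swap-factors (M zero j) (β k) _) ⟩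
    sumP N (λ k → β k *P (M zero j *P det s (minor j (Ms k)))) ≈⟨ sumP-cong N (λ k → *P-congʳ (β k) (*P-congˡ _ (same-off-c₀ k zero j j≢c₀))) ⟩
    sumP N (λ k → β k *P term k j)                             ∎
    where
    c₀′ : Fin s
    c₀′ = punchOut j≢c₀
    punchIn-c₀′ : punchIn j c₀′ ≡ c₀
    punchIn-c₀′ = Finₚ.punchIn-punchOut j≢c₀
    minor-linear : det s (minor j M) ≈P sumP N (λ k → β k *P det s (minor j (Ms k)))
    minor-linear = det-linear s (minor j M) N β (λ k → minor j (Ms k)) c₀′
      (λ k r c c≢c₀′ → same-off-c₀ k (suc r) (punchIn j c)
         (λ eq → c≢c₀′ (Finₚ.punchIn-injective j c c₀′ (trans eq (sym punchIn-c₀′)))))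
      (λ r → subst (λ c → M (suc r) c ≈P sumP N (λ k → β k *P Ms k (suc r) c)) (sym punchIn-c₀′) (column-c₀ (suc r)))

data Adjacent : ∀ {n} → Fin n → Fin n → Set where
  first : ∀ {n} → Adjacent {suc (suc n)} zero (suc zero)
  later : ∀ {n} {a b : Fin n} → Adjacent a b → Adjacent (suc a) (suc b)

adjacent-toℕ : ∀ {n} (a b : Fin n) → toℕ b ≡ suc (toℕ a) → Adjacent a b
adjacent-toℕ zero    (suc zero)    _  = first
adjacent-toℕ zero    (suc (suc b)) ()
adjacent-toℕ (suc a) (suc b)       eq = later (adjacent-toℕ a b (ℕₚ.suc-injective eq))

adjacent-punchOut : ∀ {n} {a b j : Fin (suc n)} → Adjacent a b →
                    (j≢a : j ≢ a) (j≢b : j ≢ b) → Adjacent (punchOut j≢a) (punchOut j≢b)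
adjacent-punchOut {j = zero}                          first       j≢a j≢b = ⊥-elim (j≢a refl)
adjacent-punchOut {j = zero}                          (later adj) j≢a j≢b = adj
adjacent-punchOut {j = suc zero}                      first       j≢a j≢b = ⊥-elim (j≢b refl)
adjacent-punchOut {n = suc (suc n)} {j = suc (suc j)} first       j≢a j≢b = first
adjacent-punchOut {n = suc n}       {j = suc j}       (later adj) j≢a j≢b =
  later (adjacent-punchOut adj (j≢a ∘ cong suc) (j≢b ∘ cong suc))

adjacent-punchIn : ∀ {n} {a b : Fin (suc n)} → Adjacent a b → ∀ x →
                   punchIn a x ≡ punchIn b x ⊎ (punchIn a x ≡ b × punchIn b x ≡ a)
adjacent-punchIn first   zero    = inj₂ (refl , refl)
adjacent-punchIn first   (suc x) = inj₁ refl
adjacent-punchIn (later adj) zero = inj₁ refl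
adjacent-punchIn {suc n} (later adj) (suc x) with adjacent-punchIn adj x
... | inj₁ eq           = inj₁ (cong suc eq)
... | inj₂ (eq₁ , eq₂) = inj₂ (cong suc eq₁ , cong suc eq₂)

altSumP-swap : ∀ {n} {a b : Fin n} (f g : Fin n → Poly) → Adjacent a b →
               (∀ j → j ≢ a → j ≢ b → g j ≈P -P f j) → g a ≈P f b → g b ≈P f a →
               altSumP n g ≈P -P altSumP n f
altSumP-swap {suc (suc n)} f g first g-other g-a g-b =
  ≈P-trans (+P-cong g-a (-P-cong (+P-cong g-b (-P-cong rest))))
           (regroup (f zero) (f (suc zero)) (altSumP n (λ k → f (suc (suc k)))))
  where
  rest : altSumP n (λ k → g (suc (suc k))) ≈P -P altSumP n (λ k → f (suc (suc k)))
  rest = ≈P-trans (altSumP-cong n (λ k → g-other (suc (suc k)) (λ ()) (λ ())))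
                  (altSumP--P n (λ k → f (suc (suc k))))
  regroup : ∀ x y z → y +P (-P (x +P (-P (-P z)))) ≈P -P (x +P (-P (y +P (-P z))))
  regroup = solve-∀ polyRing′
altSumP-swap {suc n} f g (later adj) g-other g-a g-b =
  ≈P-trans (+P-cong (g-other zero (λ ()) (λ ()))
                    (-P-cong (altSumP-swap (λ j → f (suc j)) (λ j → g (suc j)) adj
                               (λ j j≢a j≢b → g-other (suc j) (j≢a ∘ Finₚ.suc-injective) (j≢b ∘ Finₚ.suc-injective))
                               g-a g-b)))
           (regroup (f zero) (altSumP n (λ j → f (suc j))))
  where
  regroup : ∀ x z → (-P x) +P (-P (-P z)) ≈P -P (x +P (-P z))
  regroup = solve-∀ polyRing′

-- By induction
-- along the Laplace expansion: a minor avoiding both columns has them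
-- swapped, and the two minors at the swapped columns are exchanged.
det-swap : ∀ s (M M′ : Matrix s) {a b : Fin s} → Adjacent a b →
           (∀ r → M′ r a ≈P M r b) → (∀ r → M′ r b ≈P M r a) →
           (∀ r c → c ≢ a → c ≢ b → M′ r c ≈P M r c) →
           det s M′ ≈P -P det s M
det-swap (suc s) M M′ {a} {b} adj M′-a M′-b M′-other =
  altSumP-swap _ _ adj other-term (*P-cong (M′-a zero) (det-cong s minor-a)) (*P-cong (M′-b zero) (det-cong s minor-b))
  where
  in-minor : ∀ {j x y} (j≢x : j ≢ x) (j≢y : j ≢ y) → (∀ r → M′ r x ≈P M r y) →
             ∀ r → minor j M′ r (punchOut j≢x) ≈P minor j M r (punchOut j≢y)
  in-minor j≢x j≢y M′x≈My r = subst₂ (λ c d → M′ (suc r) c ≈P M (suc r) d)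
    (sym (Finₚ.punchIn-punchOut j≢x)) (sym (Finₚ.punchIn-punchOut j≢y)) (M′x≈My (suc r))
  other-term : ∀ j → j ≢ a → j ≢ b → M′ zero j *P det s (minor j M′) ≈P -P (M zero j *P det s (minor j M))
  other-term j j≢a j≢b =
    ≈P-trans (*P-cong (M′-other zero j j≢a j≢b) (det-swap s (minor j M) (minor j M′) (adjacent-punchOut adj j≢a j≢b)
        (in-minor j≢a j≢b M′-a) (in-minor j≢b j≢a M′-b)
        (λ r c c≢a c≢b → M′-other (suc r) (punchIn j c)
           (λ eq → c≢a (Finₚ.punchIn-injective j c _ (trans eq (sym (Finₚ.punchIn-punchOut j≢a)))))
           (λ eq → c≢b (Finₚ.punchIn-injective j c _ (trans eq (sym (Finₚ.punchIn-punchOut j≢b))))))))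
      (times-neg (M zero j) (det s (minor j M)))
    where
    times-neg : ∀ x y → x *P (-P y) ≈P -P (x *P y)
    times-neg = solve-∀ polyRing′
  fixed : ∀ r x → punchIn a x ≡ punchIn b x → M′ (suc r) (punchIn a x) ≈P M (suc r) (punchIn a x)
  fixed r x eq = M′-other (suc r) (punchIn a x) (Finₚ.punchInᵢ≢i a x) (λ eq′ → Finₚ.punchInᵢ≢i b x (trans (sym eq) eq′))
  minor-a : ∀ r x → minor a M′ r x ≈P minor b M r x
  minor-a r x with adjacent-punchIn adj x
  ... | inj₁ eq           = subst (λ c → M′ (suc r) (punchIn a x) ≈P M (suc r) c) eq (fixed r x eq)
  ... | inj₂ (eq₁ , eq₂) = subst₂ (λ c d → M′ (suc r) c ≈P M (suc r) d) (sym eq₁) (sym eq₂) (M′-b (suc r))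
  minor-b : ∀ r x → minor b M′ r x ≈P minor a M r x
  minor-b r x with adjacent-punchIn adj x
  ... | inj₁ eq           = subst (λ c → M′ (suc r) c ≈P M (suc r) (punchIn a x)) eq (fixed r x eq)
  ... | inj₂ (eq₁ , eq₂) = subst₂ (λ c d → M′ (suc r) c ≈P M (suc r) d) (sym eq₂) (sym eq₁) (M′-a (suc r))

ℚ-self-negating : ∀ {c} → c ≡ ℚ.- c → c ≡ 0ℚ
ℚ-self-negating {c} c≡-c with ℚₚ.<-cmp c 0ℚ
... | tri< c<0 _ _ = ⊥-elim (ℚₚ.<-asym c<0 (subst (0ℚ ℚ.<_) (sym c≡-c) (ℚₚ.neg-antimono-< c<0)))
... | tri≈ _ c≡0 _ = c≡0
... | tri> _ _ c>0 = ⊥-elim (ℚₚ.<-asym c>0 (subst (ℚ._< 0ℚ) (sym c≡-c) (ℚₚ.neg-antimono-< c>0)))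

self-negating : ∀ {p} → p ≈P -P p → p ≈P []
self-negating {p} p≈-p = coeffwise λ k → ℚ-self-negating (trans (coeff-≡ p≈-p k) (coeff--P p k))

-- Two equal adjacent columns: swapping them changes nothing, yet negates
-- the determinant, so it vanishes.
det-adjacent-equal : ∀ s (M : Matrix s) {a b : Fin s} → Adjacent a b → (∀ r → M r a ≈P M r b) → det s M ≈P []
det-adjacent-equal s M adj a≈b =
  self-negating (det-swap s M M adj (λ r → a≈b r) (λ r → ≈P-sym (a≈b r)) (λ r c _ _ → ≈P-refl))

transpose-left : ∀ {n} (a b : Fin n) → transpose a b a ≡ b
transpose-left a b with a Fin.≟ a
... | yes _   = refl
... | no  a≢a = ⊥-elim (a≢a refl)

transpose-right : ∀ {n} (a b : Fin n) → transpose a b b ≡ a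
transpose-right a b with b Fin.≟ a
... | yes b≡a = b≡a
... | no  _ with b Fin.≟ b
...   | yes _   = refl
...   | no  b≢b = ⊥-elim (b≢b refl)

transpose-other : ∀ {n} (a b c : Fin n) → c ≢ a → c ≢ b → transpose a b c ≡ c
transpose-other a b c c≢a c≢b with c Fin.≟ a
... | yes c≡a = ⊥-elim (c≢a c≡a)
... | no  _ with c Fin.≟ b
...   | yes c≡b = ⊥-elim (c≢b c≡b)
...   | no  _   = refl

-- Two equal columns p, q at distance d + 1: swap q with its left
-- neighbour to bring the equal columns to distance d.
det-equal-columns-at : ∀ d s (M : Matrix s) (p q : Fin s) → toℕ q ≡ suc (d ℕ.+ toℕ p) →
                       (∀ r → M r p ≈P M r q) → det s M ≈P []
det-equal-columns-at zero    s       M p q       q≡1+p p≈q = det-adjacent-equal s M (adjacent-toℕ p q q≡1+p) p≈q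
det-equal-columns-at (suc d) s       M p zero    ()
det-equal-columns-at (suc d) (suc s) M p (suc q) q≡2+d+p p≈q = begin
  det (suc s) M                ≈⟨ double-negation (det (suc s) M) ⟨
  -P (-P det (suc s) M)        ≈⟨ -P-cong swapped ⟨
  -P det (suc s) M′            ≈⟨ -P-cong (det-equal-columns-at d (suc s) M′ p q′ q′≡1+d+p p≈q′) ⟩
  -P []                        ∎
  where
  open SetoidReasoning ≈P-setoid
  double-negation : ∀ x → -P (-P x) ≈P x
  double-negation = solve-∀ polyRing′
  q′ : Fin (suc s)
  q′ = Fin.inject₁ q
  q′≡1+d+p : toℕ q′ ≡ suc (d ℕ.+ toℕ p)
  q′≡1+d+p = trans (Finₚ.toℕ-inject₁ q) (ℕₚ.suc-injective q≡2+d+p)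
  adj : Adjacent q′ (suc q)
  adj = adjacent-toℕ q′ (suc q) (cong suc (sym (Finₚ.toℕ-inject₁ q)))
  M′ : Matrix (suc s)
  M′ r c = M r (transpose q′ (suc q) c)
  swapped : det (suc s) M′ ≈P -P det (suc s) M
  swapped = det-swap (suc s) M M′ adj
    (λ r → ≈P-reflexive (cong (M r) (transpose-left q′ (suc q))))
    (λ r → ≈P-reflexive (cong (M r) (transpose-right q′ (suc q))))
    (λ r c c≢q′ c≢q → ≈P-reflexive (cong (M r) (transpose-other q′ (suc q) c c≢q′ c≢q)))
  p≢q′ : p ≢ q′
  p≢q′ eq = ℕₚ.<-irrefl (cong toℕ eq) (subst (toℕ p <_) (sym q′≡1+d+p) (s≤s (ℕₚ.m≤n+m (toℕ p) d)))
  p≢q : p ≢ suc q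
  p≢q eq = ℕₚ.<-irrefl (cong toℕ eq) (subst (toℕ p <_) (sym q≡2+d+p) (s≤s (ℕₚ.m≤n+m (toℕ p) (suc d))))
  p≈q′ : ∀ r → M′ r p ≈P M′ r q′
  p≈q′ r = subst₂ (λ c c′ → M r c ≈P M r c′)
    (sym (transpose-other q′ (suc q) p p≢q′ p≢q)) (sym (transpose-left q′ (suc q))) (p≈q r)

distance : ∀ {m n} → m < n → n ≡ suc ((n ∸ suc m) ℕ.+ m)
distance {m} m<n = sym (trans (sym (ℕₚ.+-suc _ m)) (ℕₚ.m∸n+n≡m m<n))

det-equal-columns : ∀ s (M : Matrix s) (p q : Fin s) → p ≢ q → (∀ r → M r p ≈P M r q) → det s M ≈P []
det-equal-columns s M p q p≢q p≈q with ℕₚ.<-cmp (toℕ p) (toℕ q)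
... | tri< p<q _ _ = det-equal-columns-at _ s M p q (distance p<q) p≈q
... | tri≈ _ p≡q _ = ⊥-elim (p≢q (Finₚ.toℕ-injective p≡q))
... | tri> _ _ q<p = det-equal-columns-at _ s M q p (distance q<p) (λ r → ≈P-sym (p≈q r))


binomConst : ℕ → ℕ → Poly
binomConst y       zero    = oneP
binomConst zero    (suc k) = []
binomConst (suc y) (suc k) = binomConst y k +P binomConst y (suc k)

deg-binomConst : ∀ y k → DegAtMost (binomConst y k) 0 0
deg-binomConst y       zero    = deg-oneP
deg-binomConst zero    (suc k) = deg-zero 0 0 ≈P-refl
deg-binomConst (suc y) (suc k) = deg-+P (deg-binomConst y k) (deg-binomConst y (suc k))

Δ : (ℕ → Poly) → ℕ → Poly
Δ g y = g (suc y) +P (-P g y)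

Δ^ : ℕ → (ℕ → Poly) → ℕ → Poly
Δ^ zero    g = g
Δ^ (suc k) g = Δ^ k (Δ g)

Δ^-cong : ∀ k {g h : ℕ → Poly} → (∀ y → g y ≈P h y) → ∀ y → Δ^ k g y ≈P Δ^ k h y
Δ^-cong zero    g≈h = g≈h
Δ^-cong (suc k) g≈h = Δ^-cong k (λ y → +P-cong (g≈h (suc y)) (-P-cong (g≈h y)))

Δ^-shift : ∀ k (g : ℕ → Poly) y → Δ^ k (λ y → g (suc y)) y ≈P Δ^ k g (suc y)
Δ^-shift zero    g y = ≈P-refl
Δ^-shift (suc k) g y = Δ^-shift k (Δ g) y

Δ^-const-zero : ∀ k y → Δ^ k (λ _ → []) y ≈P []
Δ^-const-zero zero    y = ≈P-refl
Δ^-const-zero (suc k) y = Δ^-const-zero k y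

-- By induction on N (applied to Δ g) and, inside, on y, using
-- g (y+1) = g y + (Δ g) y and Pascal's rule for binom(y+1, k+1).
newton : ∀ N (g : ℕ → Poly) → (∀ y → Δ^ N g y ≈P []) →
         ∀ y → g y ≈P sumP N (λ k → Δ^ (toℕ k) g 0 *P binomConst y (toℕ k))
newton zero    g Δ^N≈0 y = Δ^N≈0 y
newton (suc N) g Δ^N≈0 = expansion
  where
  β : Fin N → Poly
  β k = Δ^ (toℕ k) (Δ g) 0
  higher : ℕ → Poly
  higher y = sumP N (λ k → β k *P binomConst y (suc (toℕ k)))
  lower : ℕ → Poly
  lower y = sumP N (λ k → β k *P binomConst y (toℕ k))
  Δg-expansion : ∀ y → Δ g y ≈P lower y
  Δg-expansion = newton N (Δ g) Δ^N≈0
  higher-suc : ∀ y → higher (suc y) ≈P higher y +P lower y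
  higher-suc y = ≈P-trans
    (sumP-cong N (λ k → *P-distribˡ (β k) (binomConst y (toℕ k)) (binomConst y (suc (toℕ k)))))
    (≈P-trans (sumP-+P N (λ k → β k *P binomConst y (toℕ k)) (λ k → β k *P binomConst y (suc (toℕ k))))
              (+P-comm (lower y) (higher y)))
  add-difference : ∀ x z → x ≈P z +P (x +P (-P z))
  add-difference = solve-∀ polyRing′
  regroup : ∀ x u v → (x +P u) +P v ≈P x +P (u +P v)
  regroup = solve-∀ polyRing′
  expansion : ∀ y → g y ≈P g 0 *P oneP +P higher y
  expansion zero = ≈P-sym (≈P-trans (+P-cong (*P-identityʳ (g 0)) (sumP-zero N (λ k → *P-zeroʳ (β k))))
                                    (+P-identityʳ (g 0)))
  expansion (suc y) = begin
    g (suc y)                                  ≈⟨ add-difference (g (suc y)) (g y) ⟩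
    g y +P Δ g y                               ≈⟨ +P-cong (expansion y) (Δg-expansion y) ⟩
    (g 0 *P oneP +P higher y) +P lower y       ≈⟨ regroup (g 0 *P oneP) (higher y) (lower y) ⟩
    g 0 *P oneP +P (higher y +P lower y)       ≈⟨ +P-cong (≈P-refl {g 0 *P oneP}) (higher-suc y) ⟨
    g 0 *P oneP +P higher (suc y)              ∎
    where open SetoidReasoning ≈P-setoid

column : ℕ → ℕ → Poly
column j y = binomP (y ℕ.+ j) j

-- deg (Δ^k column j) y ≤ j − k: each difference lowers the degree, since
-- by Pascal's rule  Δ (column (j+1)) y = column j (y+1),  while column 0
-- is the constant 1.
deg-Δ^-column : ∀ j k y → DegAtMost (Δ^ k (column j) y) j k
deg-Δ^-column j       zero    y = deg-weaken ℕₚ.≤-refl (deg-binomP (y ℕ.+ j) j)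
deg-Δ^-column zero    (suc k) y =
  deg-zero 0 (suc k) (≈P-trans (Δ^-cong k (λ y → -P-inverseʳ (column zero y)) y) (Δ^-const-zero k y))
deg-Δ^-column (suc j) (suc k) y =
  deg-weaken (ℕₚ.≤-reflexive (ℕₚ.+-suc j k))
    (deg-cong (≈P-sym (≈P-trans (Δ^-cong k Δ-column y) (Δ^-shift k (column j) y))) (deg-Δ^-column j k (suc y)))
  where
  Δ-column : ∀ y → Δ (column (suc j)) y ≈P column j (suc y)
  Δ-column y = begin
    binomP (suc y ℕ.+ suc j) (suc j) +P (-P column (suc j) y)
      ≈⟨ +P-cong (pascal (y ℕ.+ suc j) j) (≈P-refl { -P column (suc j) y}) ⟩
    (column (suc j) y +P binomP (y ℕ.+ suc j) j) +P (-P column (suc j) y)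
      ≈⟨ cancel (column (suc j) y) (binomP (y ℕ.+ suc j) j) ⟩
    binomP (y ℕ.+ suc j) j
      ≡⟨ cong (λ c → binomP c j) (ℕₚ.+-suc y j) ⟩
    column j (suc y) ∎
    where
    open SetoidReasoning ≈P-setoid
    cancel : ∀ x z → (x +P z) +P (-P x) ≈P z
    cancel = solve-∀ polyRing′

column-expansion : ∀ n j → j < n → ∀ y →
                   column j y ≈P sumP n (λ k → Δ^ (toℕ k) (column j) 0 *P binomConst y (toℕ k))
column-expansion n j j<n = newton n (column j) (λ y → deg-negative j<n (deg-Δ^-column j n y))

sumℕ-cong : ∀ s {f g : Fin s → ℕ} → (∀ c → f c ≡ g c) → sumℕ s f ≡ sumℕ s g
sumℕ-cong zero    f≡g = refl
sumℕ-cong (suc s) f≡g = cong₂ ℕ._+_ (f≡g zero) (sumℕ-cong s (λ c → f≡g (suc c)))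

sumℕ-punchIn : ∀ s (f : Fin (suc s) → ℕ) c → sumℕ (suc s) f ≡ f c ℕ.+ sumℕ s (f ∘ punchIn c)
sumℕ-punchIn s       f zero    = refl
sumℕ-punchIn (suc s) f (suc c) =
  trans (cong (f zero ℕ.+_) (sumℕ-punchIn s (f ∘ suc) c))
        (ℕ+.x∙yz≈y∙xz (f zero) (f (suc c)) (sumℕ s (f ∘ suc ∘ punchIn c)))

sumℕ-exchange : ∀ s (f g : Fin s → ℕ) c₀ → (∀ c → c ≢ c₀ → f c ≡ g c) →
                f c₀ ℕ.+ sumℕ s g ≡ g c₀ ℕ.+ sumℕ s f
sumℕ-exchange (suc s) f g c₀ f≡g = begin
  f c₀ ℕ.+ sumℕ (suc s) g                              ≡⟨ cong (f c₀ ℕ.+_) (sumℕ-punchIn s g c₀) ⟩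
  f c₀ ℕ.+ (g c₀ ℕ.+ sumℕ s (g ∘ punchIn c₀))          ≡⟨ cong (λ z → f c₀ ℕ.+ (g c₀ ℕ.+ z)) rest ⟩
  f c₀ ℕ.+ (g c₀ ℕ.+ sumℕ s (f ∘ punchIn c₀))          ≡⟨ ℕ+.x∙yz≈y∙xz (f c₀) (g c₀) _ ⟩
  g c₀ ℕ.+ (f c₀ ℕ.+ sumℕ s (f ∘ punchIn c₀))          ≡⟨ cong (g c₀ ℕ.+_) (sumℕ-punchIn s f c₀) ⟨
  g c₀ ℕ.+ sumℕ (suc s) f                              ∎
  where
  open ≡-Reasoning
  rest : sumℕ s (g ∘ punchIn c₀) ≡ sumℕ s (f ∘ punchIn c₀)
  rest = sumℕ-cong s (λ c → sym (f≡g (punchIn c₀ c) (Finₚ.punchInᵢ≢i c₀ c)))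

sumℕ-∸ : ∀ s (f g : Fin s → ℕ) → (∀ c → g c ≤ f c) → sumℕ s (λ c → f c ∸ g c) ℕ.+ sumℕ s g ≡ sumℕ s f
sumℕ-∸ zero    f g g≤f = refl
sumℕ-∸ (suc s) f g g≤f = begin
  (f zero ∸ g zero ℕ.+ Σ[f∸g]) ℕ.+ (g zero ℕ.+ Σg)     ≡⟨ ℕ+.interchange (f zero ∸ g zero) Σ[f∸g] (g zero) Σg ⟩
  (f zero ∸ g zero ℕ.+ g zero) ℕ.+ (Σ[f∸g] ℕ.+ Σg)
    ≡⟨ cong₂ ℕ._+_ (ℕₚ.m∸n+n≡m (g≤f zero)) (sumℕ-∸ s (f ∘ suc) (g ∘ suc) (g≤f ∘ suc)) ⟩
  f zero ℕ.+ sumℕ s (f ∘ suc)                          ∎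
  where
  open ≡-Reasoning
  Σ[f∸g] Σg : ℕ
  Σ[f∸g] = sumℕ s (λ c → f (suc c) ∸ g (suc c))
  Σg = sumℕ s (g ∘ suc)

-- triangle s = 0 + 1 + ⋯ + (s − 1), the least possible value of a sum of
-- s distinct natural numbers.
triangle : ℕ → ℕ
triangle s = sumℕ s toℕ

triangle-suc : ∀ s → triangle (suc s) ≡ s ℕ.+ triangle s
triangle-suc s = sumℕ-suc s toℕ
  where
  sumℕ-suc : ∀ s (f : Fin s → ℕ) → sumℕ s (suc ∘ f) ≡ s ℕ.+ sumℕ s f
  sumℕ-suc zero    f = refl
  sumℕ-suc (suc s) f = cong suc (trans (cong (f zero ℕ.+_) (sumℕ-suc s (f ∘ suc)))
                                       (ℕ+.x∙yz≈y∙xz (f zero) s (sumℕ s (f ∘ suc))))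

-- If some value κ c is ≥ s − 1, remove c and recurse; otherwise all s
-- values lie below s − 1 and the pigeonhole principle gives a repetition.
repeated-or-large : ∀ s (κ : Fin s → ℕ) →
                    (Σ (Fin s) λ c → Σ (Fin s) λ c′ → c ≢ c′ × κ c ≡ κ c′) ⊎ (triangle s ≤ sumℕ s κ)
repeated-or-large zero    κ = inj₂ z≤n
repeated-or-large (suc s) κ with Finₚ.any? (λ c → s ℕ.≤? κ c)
... | yes (c , s≤κc) with repeated-or-large s (κ ∘ punchIn c)
...   | inj₁ (d , d′ , d≢d′ , eq) = inj₁ (punchIn c d , punchIn c d′ , d≢d′ ∘ Finₚ.punchIn-injective c d d′ , eq)
...   | inj₂ large = inj₂ (subst₂ _≤_ (sym (triangle-suc s)) (sym (sumℕ-punchIn s κ c)) (ℕₚ.+-mono-≤ s≤κc large))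
repeated-or-large (suc s) κ | no none-large =
  let (i , j , i<j , same-box) = Finₚ.pigeonhole (ℕₚ.n<1+n s) (λ c → Fin.fromℕ< (small c))
  in inj₁ (i , j , (λ i≡j → ℕₚ.<-irrefl (cong toℕ i≡j) i<j) ,
           trans (sym (Finₚ.toℕ-fromℕ< (small i))) (trans (cong toℕ same-box) (Finₚ.toℕ-fromℕ< (small j))))
  where
  small : ∀ c → κ c < s
  small c = ℕₚ.≰⇒> (λ s≤κc → none-large (c , s≤κc))

increasing-≥ : ∀ {s n} (J : Fin s → Fin n) → StrictlyIncreasing J → ∀ c → toℕ c ≤ toℕ (J c)
increasing-≥ {s} J increasing c =
  subst (λ c′ → toℕ c ≤ toℕ (J c′)) (Finₚ.fromℕ<-toℕ c (Finₚ.toℕ<n c)) (at (toℕ c) (Finₚ.toℕ<n c))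
  where
  at : ∀ m (m<s : m < s) → m ≤ toℕ (J (Fin.fromℕ< m<s))
  at zero    _     = z≤n
  at (suc m) 1+m<s = ℕₚ.≤-<-trans (at m m<s) (increasing _ _ step)
    where
    m<s : m < s
    m<s = ℕₚ.<-trans (ℕₚ.n<1+n m) 1+m<s
    step : toℕ (Fin.fromℕ< m<s) < toℕ (Fin.fromℕ< 1+m<s)
    step = subst₂ _<_ (sym (Finₚ.toℕ-fromℕ< m<s)) (sym (Finₚ.toℕ-fromℕ< 1+m<s)) (ℕₚ.n<1+n m)

module ColumnExpansion {s n : ℕ} (v : ℕ → Fin s → Poly) (v-const : ∀ k r → DegAtMost (v k r) 0 0)
                       (β : Fin s → Fin n → Poly) where

  combination : Fin s → Fin s → Poly
  combination r c = sumP n (λ k → β c k *P v (toℕ k) r)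

  -- Expand column m by multilinearity; once all columns are expanded, a
  -- repeated vector kills the determinant, and otherwise Σ w ≥ triangle s.
  expand : ∀ d m → d ℕ.+ m ≡ s → ∀ (w : Fin s → ℕ) (M : Matrix s) →
           (∀ r c → toℕ c < m → M r c ≈P v (w c) r) →
           (∀ r c → m ≤ toℕ c → M r c ≈P combination r c) →
           (∀ c k → m ≤ toℕ c → DegAtMost (β c k) (w c) (toℕ k)) →
           DegAtMost (det s M) (sumℕ s w) (triangle s)
  expand zero m refl w M pure _ _ with repeated-or-large m w
  ... | inj₁ (c , c′ , c≢c′ , wc≡wc′) = deg-zero _ _ (det-equal-columns m M c c′ c≢c′ λ r →
          ≈P-trans (pure r c (Finₚ.toℕ<n c)) (≈P-trans (≈P-reflexive (cong (λ k → v k r) wc≡wc′))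
                   (≈P-sym (pure r c′ (Finₚ.toℕ<n c′)))))
  ... | inj₂ triangle≤Σw = deg-weaken (subst (triangle m ≤_) (sym (ℕₚ.+-identityʳ _)) triangle≤Σw)
          (deg-det-const m M (λ r c → deg-cong (≈P-sym (pure r c (Finₚ.toℕ<n c))) (v-const (w c) r)))
  expand (suc d) m d+m≡s w M pure mixed deg-β =
    deg-cong (≈P-sym linear) (deg-sumP n _ term-bound)
    where
    m<s : m < s
    m<s = subst (m <_) d+m≡s (s≤s (ℕₚ.m≤n+m m d))
    c₀ : Fin s
    c₀ = Fin.fromℕ< m<s
    toℕ-c₀ : toℕ c₀ ≡ m
    toℕ-c₀ = Finₚ.toℕ-fromℕ< m<s
    Ms : Fin n → Matrix s
    Ms k r = updateAt (M r) c₀ (λ _ → v (toℕ k) r)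
    ws : Fin n → Fin s → ℕ
    ws k = updateAt w c₀ (λ _ → toℕ k)
    linear : det s M ≈P sumP n (λ k → β c₀ k *P det s (Ms k))
    linear = det-linear s M n (β c₀) Ms c₀
      (λ k r c c≢c₀ → ≈P-reflexive (sym (updateAt-minimal c c₀ (M r) c≢c₀)))
      (λ r → ≈P-trans (mixed r c₀ (ℕₚ.≤-reflexive (sym toℕ-c₀)))
               (sumP-cong n (λ k → *P-congʳ (β c₀ k) (≈P-reflexive (sym (updateAt-updates c₀ (M r)))))))
    c≢c₀ : ∀ {c} → toℕ c ≢ m → c ≢ c₀
    c≢c₀ toℕ-c≢m c≡c₀ = toℕ-c≢m (trans (cong toℕ c≡c₀) toℕ-c₀)
    expanded : ∀ k → DegAtMost (det s (Ms k)) (sumℕ s (ws k)) (triangle s)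
    expanded k = expand d (suc m) (trans (ℕₚ.+-suc d m) d+m≡s) (ws k) (Ms k) pure′ mixed′ deg-β′
      where
      pure′ : ∀ r c → toℕ c < suc m → Ms k r c ≈P v (ws k c) r
      pure′ r c c<1+m with c Fin.≟ c₀
      ... | yes refl = ≈P-reflexive (trans (updateAt-updates c₀ (M r)) (cong (λ j → v j r) (sym (updateAt-updates c₀ w))))
      ... | no  c≢c₀′ = ≈P-trans (≈P-reflexive (updateAt-minimal c c₀ (M r) c≢c₀′))
          (≈P-trans (pure r c c<m) (≈P-reflexive (cong (λ j → v j r) (sym (updateAt-minimal c c₀ w c≢c₀′)))))
        where
        c<m : toℕ c < m
        c<m = ℕₚ.≤∧≢⇒< (ℕₚ.m<1+n⇒m≤n c<1+m) (λ eq → c≢c₀′ (Finₚ.toℕ-injective (trans eq (sym toℕ-c₀))))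
      mixed′ : ∀ r c → suc m ≤ toℕ c → Ms k r c ≈P combination r c
      mixed′ r c 1+m≤c = ≈P-trans (≈P-reflexive (updateAt-minimal c c₀ (M r) (c≢c₀ λ eq → ℕₚ.<-irrefl (sym eq) 1+m≤c)))
                                  (mixed r c (ℕₚ.<⇒≤ 1+m≤c))
      deg-β′ : ∀ c j → suc m ≤ toℕ c → DegAtMost (β c j) (ws k c) (toℕ j)
      deg-β′ c j 1+m≤c = subst (λ x → DegAtMost (β c j) x (toℕ j))
        (sym (updateAt-minimal c c₀ w (c≢c₀ λ eq → ℕₚ.<-irrefl (sym eq) 1+m≤c))) (deg-β c j (ℕₚ.<⇒≤ 1+m≤c))
    -- w c₀ + Σ wₖ = k + Σ w, so the k-th term obeys the bound for det M
    weights : ∀ k → w c₀ ℕ.+ sumℕ s (ws k) ≡ toℕ k ℕ.+ sumℕ s w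
    weights k = trans (sumℕ-exchange s w (ws k) c₀ (λ c c≢c₀ → sym (updateAt-minimal c c₀ w c≢c₀)))
                      (cong (ℕ._+ sumℕ s w) (updateAt-updates c₀ w))
    term-bound : ∀ k → DegAtMost (β c₀ k *P det s (Ms k)) (sumℕ s w) (triangle s)
    term-bound k = deg-weaken
      (ℕₚ.≤-reflexive (trans (cong (ℕ._+ triangle s) (weights k)) (ℕ+.xy∙z≈y∙xz (toℕ k) (sumℕ s w) (triangle s))))
      (deg-*P (deg-β c₀ k (ℕₚ.≤-reflexive (sym toℕ-c₀))) (expanded k))

  deg-det-combinations : ∀ (w : Fin s → ℕ) (M : Matrix s) → (∀ r c → M r c ≈P combination r c) →
                         (∀ c k → DegAtMost (β c k) (w c) (toℕ k)) →
                         DegAtMost (det s M) (sumℕ s w) (triangle s)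
  deg-det-combinations w M M≈combination deg-β =
    expand s 0 (ℕₚ.+-identityʳ s) w M (λ _ _ ()) (λ r c _ → M≈combination r c) (λ c k _ → deg-β c k)

-- Lemma 10.  Entry (i, j) of B(n)_I^J is column (J j) (I i), which
-- Newton's formula writes as Σ_{k<n} (Δ^k column (J j))(0) · binom(I i, k),
-- a combination of the constant vectors binom(I i, k) with coefficients of
-- degree ≤ J j − k.  The column-expansion bound then gives
-- deg det ≤ Σ_j J j − (0 + 1 + ⋯ + (s−1)) = Σ_j (J j − j).
lemma10 : (n : ℕ) → .{{_ : NonZero n}} → (s : ℕ) →
          (I J : Fin s → Fin n) →
          StrictlyIncreasing I → StrictlyIncreasing J →
          DegLe (det s (sub (B n) I J)) (boundSum J)
lemma10 n s I J _ J-increasing k bound<k =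
  vanishes deg-det k (subst (boundSum J <_) (sym (ℕₚ.+-identityʳ k)) bound<k)
  where
  open ColumnExpansion {s} {n} (λ k r → binomConst (toℕ (I r)) k) (λ k r → deg-binomConst (toℕ (I r)) k)
                       (λ c k → Δ^ (toℕ k) (column (toℕ (J c))) 0)
  entries : ∀ r c → sub (B n) I J r c ≈P combination r c
  entries r c = column-expansion n (toℕ (J c)) (Finₚ.toℕ<n (J c)) (toℕ (I r))
  bound-split : boundSum J ℕ.+ triangle s ≡ sumℕ s (toℕ ∘ J)
  bound-split = sumℕ-∸ s (toℕ ∘ J) toℕ (increasing-≥ J J-increasing)
  deg-det : DegAtMost (det s (sub (B n) I J)) (boundSum J) 0
  deg-det = deg-weaken (ℕₚ.≤-reflexive (trans (ℕₚ.+-identityʳ _) (sym bound-split)))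
    (deg-det-combinations (toℕ ∘ J) (sub (B n) I J) entries (λ c k → deg-Δ^-column (toℕ (J c)) (toℕ k) 0))
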